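{- Let $m\ge1$, $V=GF(2)^{2m}$, and let $\mathcal{D}$ be a non-trivial $2$-$(2^{2m},2^{m},\lambda)$ design with point set $V$, $\lambda\mid 2^m$, admitting a flag-transitive automorphism group $G=T:G_0\le AGL(V)$ with $T$ the translation group of $V$. Write $|T_B|=2^t$ for a block $B$. If $t\ge m-1$, then every block of $\mathcal{D}$ is a coset of a $GF(2)$-subspace of $V$ (the blocks are subspaces of $AG_{2m}(2)$).
   Context: A $2$-$(v,k,\lambda)$ design has $v$ points and $k$-subsets (blocks), every two distinct points lying in exactly $\lambda$ blocks; non-trivial means $2<k<v$. Flag-transitive: transitive on pairs $(x,B)$ with $x\in B$. $T_B$ is the stabilizer of $B$ in $T$ (its order does not depend on $B$ since $G$ is block-transitive and $T\trianglelefteq G$). -}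

module Defs where

open import Data.Bool using (Bool; true; false; _∧_; _xor_; not)
open import Data.Bool.Properties using () renaming (_≟_ to _≟B_)
open import Data.Nat using (ℕ; zero; suc; _*_)
open import Data.Fin using (Fin)
open import Data.Vec using (Vec; []; _∷_; zipWith; replicate; lookup; tabulate; foldr)
open import Data.List using (List; []; _∷_; _++_; map; length; filterᵇ)
open import Data.List.Membership.Propositional using (_∈_)
open import Data.List.Relation.Unary.AllPairs using (AllPairs)
open import Data.Product using (Σ; _×_; _,_; ∃-syntax)
open import Relation.Binary.PropositionalEquality using (_≡_; _≢_)
open import Relation.Nullary using (¬_; does)

-- Vectors of GF(2)^n, with GF(2) = Bool (xor = addition, ∧ = multiplication)
Vc : ℕ → Set
Vc n = Vec Bool n

_⊕_ : ∀ {n} → Vc n → Vc n → Vc n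
_⊕_ = zipWith _xor_

𝟎 : ∀ {n} → Vc n
𝟎 = replicate _ false

allVecs : (n : ℕ) → List (Vc n)
allVecs zero = [] ∷ []
allVecs (suc n) = map (false ∷_) (allVecs n) ++ map (true ∷_) (allVecs n)

Subset : ℕ → Set
Subset n = Vc n → Bool

∣_∣ˢ : ∀ {n} → Subset n → ℕ
∣_∣ˢ {n} S = length (filterᵇ S (allVecs n))

_≐_ : ∀ {n} → Subset n → Subset n → Set
S ≐ R = ∀ x → S x ≡ R x

-- Matrices over GF(2): Mat n = n rows, each a vector
Mat : ℕ → Set
Mat n = Vec (Vec Bool n) n

dot : ∀ {n} → Vc n → Vc n → Bool
dot u v = foldr _ _xor_ false (zipWith _∧_ u v)

_·_ : ∀ {n} → Mat n → Vc n → Vc n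
A · v = Data.Vec.map (λ row → dot row v) A

_⊗_ : ∀ {n} → Mat n → Mat n → Mat n
_⊗_ {n} A B = tabulate (λ i → tabulate (λ j → dot (lookup A i) (tabulate (λ k → lookup (lookup B k) j))))

idMat : ∀ {n} → Mat n
idMat {n} = tabulate (λ i → tabulate (λ j → does (Data.Fin._≟_ i j)))

Invertible : ∀ {n} → Mat n → Set
Invertible {n} A = Σ (Mat n) λ A' → (A' ⊗ A ≡ idMat) × (A ⊗ A' ≡ idMat)

Aff : ℕ → Set
Aff n = Mat n × Vc n

apply : ∀ {n} → Aff n → Vc n → Vc n
apply (A , b) x = (A · x) ⊕ b

-- composition: (g ∘ h)(x) = g (h x)
_∘ₐ_ : ∀ {n} → Aff n → Aff n → Aff n
(A , b) ∘ₐ (A' , b') = (A ⊗ A') , ((A · b') ⊕ b)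

idAff : ∀ {n} → Aff n
idAff = idMat , 𝟎

translation : ∀ {n} → Vc n → Aff n
translation b = idMat , b

record IsSubgroupOfAGL {n : ℕ} (G : Aff n → Set) : Set where
  field
    inAGL : ∀ g → G g → Invertible (Data.Product.proj₁ g)
    hasId : G idAff
    closed : ∀ g h → G g → G h → G (g ∘ₐ h)
    inverses : ∀ g → G g → Σ (Aff n) λ h → G h × (h ∘ₐ g ≡ idAff) × (g ∘ₐ h ≡ idAff)

ContainsTranslations : ∀ {n} → (Aff n → Set) → Set
ContainsTranslations {n} G = ∀ (b : Vc n) → G (translation b)

-- g maps the subset B onto the subset C (g is a bijection of V)
MapsTo : ∀ {n} → Aff n → Subset n → Subset n → Set
MapsTo g B C = ∀ x → B x ≡ C (apply g x)

pairCount : ∀ {n} → List (Subset n) → Vc n → Vc n → ℕ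
pairCount blocks x y = length (filterᵇ (λ B → B x ∧ B y) blocks)

record Is2Design {n : ℕ} (blocks : List (Subset n)) (k lam : ℕ) : Set where
  field
    distinct : AllPairs (λ B C → ¬ (B ≐ C)) blocks
    blockSize : ∀ B → B ∈ blocks → ∣ B ∣ˢ ≡ k
    balanced : ∀ x y → x ≢ y → pairCount blocks x y ≡ lam

IsAutGroup : ∀ {n} → (Aff n → Set) → List (Subset n) → Set
IsAutGroup {n} G blocks =
  ∀ g → G g → ∀ B → B ∈ blocks → ∃[ C ] (C ∈ blocks × MapsTo g B C)

FlagTransitive : ∀ {n} → (Aff n → Set) → List (Subset n) → Set
FlagTransitive {n} G blocks =
  ∀ x B y C → B ∈ blocks → B x ≡ true → C ∈ blocks → C y ≡ true →
  ∃[ g ] (G g × apply g x ≡ y × MapsTo g B C)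

allᵇ : {A : Set} → (A → Bool) → List A → Bool
allᵇ p [] = true
allᵇ p (x ∷ xs) = p x ∧ allᵇ p xs

fixesᵇ : ∀ {n} → Subset n → Vc n → Bool
fixesᵇ {n} B b = allᵇ (λ x → does (B (x ⊕ b) ≟B B x)) (allVecs n)

∣T_∣ : ∀ {n} → Subset n → ℕ
∣T_∣ {n} B = length (filterᵇ (fixesᵇ B) (allVecs n))

-- GF(2)-subspace of V (scalars are 0,1, so: contains 0, closed under +)
IsSubspace : ∀ {n} → Subset n → Set
IsSubspace {n} W = (W 𝟎 ≡ true) × (∀ x y → W x ≡ true → W y ≡ true → W (x ⊕ y) ≡ true)

IsCoset : ∀ {n} → Subset n → Set
IsCoset {n} B = ∃[ W ] ∃[ a ] (IsSubspace W × (∀ x → B x ≡ W (x ⊕ a)))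

-- A set B is a coset of a GF(2)-subspace as soon as it is nonempty and closed under
-- x + y + z.  For a block B, the translations stabilising B form a subgroup S of
-- order 2^t, and B is a union of cosets of S.  If x, y, z ∈ B and none of x + y,
-- y + z, x + z lies in S, then x + S, y + S, z + S are three disjoint cosets inside B,
-- so 3 · 2^t ≤ |B| = 2^m, which is impossible when t ≥ m - 1.  Hence one of the
-- pairwise sums lies in S, and x + y + z ∈ B.  Affine maps preserve x + y + z, so
-- block-transitivity carries this closure from one block to all of them.
module Submission where

open import Defs
open import Algebra.Bundles using (CommutativeRing; CommutativeSemigroup)
import Algebra.Properties.CommutativeSemigroup as CommutativeSemigroupProperties
open import Data.Bool using (Bool; true; false; _∧_; _∨_; _xor_)
open import Data.Bool.Properties
  using (xor-assoc; xor-comm; xor-identityˡ; xor-identityʳ; xor-same;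
         ∧-distribˡ-xor; xor-∧-commutativeRing)
  renaming (_≟_ to _≟B_)
open import Data.Empty using (⊥; ⊥-elim)
open import Data.List using (List; []; _∷_; _++_; map; length; filterᵇ)
open import Data.List.Membership.Propositional using (_∈_)
open import Data.List.Membership.Propositional.Properties using (∈-++⁺ˡ; ∈-++⁺ʳ; ∈-map⁺)
open import Data.List.Relation.Unary.Any using (here; there)
open import Data.Nat using (ℕ; zero; suc; _+_; _*_; _^_; _≤_; _<_; _∸_; z≤n; s≤s)
open import Data.Nat.Divisibility using (_∣_)
open import Data.Nat.Properties
  using (+-suc; +-comm; +-identityʳ; m≤n⇒m≤1+n; ≤-refl; ≤-reflexive; ≤-trans; ≤-<-trans; <⇒≱;
         *-monoʳ-≤; *-monoˡ-<; ^-monoʳ-≤; m^n>0; m^n≢0)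
open import Data.Product using (_,_; ∃-syntax)
open import Data.Vec as Vec using (Vec; []; _∷_)
open import Data.Vec.Properties using (zipWith-assoc; zipWith-comm; zipWith-identityˡ; zipWith-identityʳ)
open import Level using (0ℓ)
open import Relation.Nullary using (does)
open import Relation.Binary.PropositionalEquality
open ≡-Reasoning

⊕-assoc : ∀ {n} (x y z : Vc n) → (x ⊕ y) ⊕ z ≡ x ⊕ (y ⊕ z)
⊕-assoc = zipWith-assoc xor-assoc

⊕-comm : ∀ {n} (x y : Vc n) → x ⊕ y ≡ y ⊕ x
⊕-comm = zipWith-comm xor-comm

⊕-identityˡ : ∀ {n} (x : Vc n) → 𝟎 ⊕ x ≡ x
⊕-identityˡ = zipWith-identityˡ xor-identityˡ

⊕-identityʳ : ∀ {n} (x : Vc n) → x ⊕ 𝟎 ≡ x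
⊕-identityʳ = zipWith-identityʳ xor-identityʳ

⊕-self : ∀ {n} (x : Vc n) → x ⊕ x ≡ 𝟎
⊕-self [] = refl
⊕-self (a ∷ x) = cong₂ _∷_ (xor-same a) (⊕-self x)

⊕-commutativeSemigroup : ℕ → CommutativeSemigroup 0ℓ 0ℓ
⊕-commutativeSemigroup n = record
  { Carrier = Vc n
  ; _≈_ = _≡_
  ; _∙_ = _⊕_
  ; isCommutativeSemigroup = record
    { isSemigroup = record
      { isMagma = record { isEquivalence = isEquivalence ; ∙-cong = cong₂ _⊕_ }
      ; assoc = ⊕-assoc
      }
    ; comm = ⊕-comm
    }
  }

module _ {n : ℕ} where
  open CommutativeSemigroupProperties (⊕-commutativeSemigroup n)
    using () renaming (interchange to ⊕-interchange; xy∙z≈y∙xz to ⊕-xy∙z≈y∙xz) public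

open CommutativeSemigroupProperties (CommutativeRing.+-commutativeSemigroup xor-∧-commutativeRing)
  using () renaming (interchange to xor-interchange)

⊕-cancelˡ : ∀ {n} (x y : Vc n) → x ⊕ (x ⊕ y) ≡ y
⊕-cancelˡ x y = begin
  x ⊕ (x ⊕ y)  ≡⟨ ⊕-assoc x x y ⟨
  (x ⊕ x) ⊕ y  ≡⟨ cong (_⊕ y) (⊕-self x) ⟩
  𝟎 ⊕ y        ≡⟨ ⊕-identityˡ y ⟩
  y            ∎

⊕-cancelʳ : ∀ {n} (x y : Vc n) → (x ⊕ y) ⊕ y ≡ x
⊕-cancelʳ x y = begin
  (x ⊕ y) ⊕ y  ≡⟨ ⊕-assoc x y y ⟩
  x ⊕ (y ⊕ y)  ≡⟨ cong (x ⊕_) (⊕-self y) ⟩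
  x ⊕ 𝟎        ≡⟨ ⊕-identityʳ x ⟩
  x            ∎

⊕-shift-pair : ∀ {n} (x y b : Vc n) → (x ⊕ b) ⊕ (y ⊕ b) ≡ x ⊕ y
⊕-shift-pair x y b = begin
  (x ⊕ b) ⊕ (y ⊕ b)  ≡⟨ ⊕-interchange x b y b ⟩
  (x ⊕ y) ⊕ (b ⊕ b)  ≡⟨ cong ((x ⊕ y) ⊕_) (⊕-self b) ⟩
  (x ⊕ y) ⊕ 𝟎        ≡⟨ ⊕-identityʳ (x ⊕ y) ⟩
  x ⊕ y              ∎

⊕-shift-triple : ∀ {n} (x y z b : Vc n) →
  ((x ⊕ b) ⊕ (y ⊕ b)) ⊕ (z ⊕ b) ≡ ((x ⊕ y) ⊕ z) ⊕ b
⊕-shift-triple x y z b = begin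
  ((x ⊕ b) ⊕ (y ⊕ b)) ⊕ (z ⊕ b)  ≡⟨ cong (_⊕ (z ⊕ b)) (⊕-shift-pair x y b) ⟩
  (x ⊕ y) ⊕ (z ⊕ b)              ≡⟨ ⊕-assoc (x ⊕ y) z b ⟨
  ((x ⊕ y) ⊕ z) ⊕ b              ∎

dot-⊕ : ∀ {n} (r x y : Vc n) → dot r (x ⊕ y) ≡ dot r x xor dot r y
dot-⊕ [] [] [] = refl
dot-⊕ (c ∷ r) (a ∷ x) (b ∷ y) = begin
  (c ∧ (a xor b)) xor dot r (x ⊕ y)                 ≡⟨ cong₂ _xor_ (∧-distribˡ-xor c a b) (dot-⊕ r x y) ⟩
  ((c ∧ a) xor (c ∧ b)) xor (dot r x xor dot r y)  ≡⟨ xor-interchange (c ∧ a) (c ∧ b) (dot r x) (dot r y) ⟩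
  ((c ∧ a) xor dot r x) xor ((c ∧ b) xor dot r y)  ∎

·-⊕ : ∀ {n} (A : Mat n) (x y : Vc n) → A · (x ⊕ y) ≡ (A · x) ⊕ (A · y)
·-⊕ A x y = go A
  where
  go : ∀ {k} (rows : Vec (Vc _) k) →
       Vec.map (λ r → dot r (x ⊕ y)) rows ≡ Vec.map (λ r → dot r x) rows ⊕ Vec.map (λ r → dot r y) rows
  go [] = refl
  go (r ∷ rows) = cong₂ _∷_ (dot-⊕ r x y) (go rows)

apply-⊕₃ : ∀ {n} (g : Aff n) (x y z : Vc n) →
  apply g ((x ⊕ y) ⊕ z) ≡ (apply g x ⊕ apply g y) ⊕ apply g z
apply-⊕₃ (A , b) x y z = begin
  (A · ((x ⊕ y) ⊕ z)) ⊕ b              ≡⟨ cong (_⊕ b) (·-⊕ A (x ⊕ y) z) ⟩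
  ((A · (x ⊕ y)) ⊕ (A · z)) ⊕ b        ≡⟨ cong (λ v → (v ⊕ (A · z)) ⊕ b) (·-⊕ A x y) ⟩
  (((A · x) ⊕ (A · y)) ⊕ (A · z)) ⊕ b  ≡⟨ ⊕-shift-triple (A · x) (A · y) (A · z) b ⟨
  (((A · x) ⊕ b) ⊕ ((A · y) ⊕ b)) ⊕ ((A · z) ⊕ b)  ∎

-- Over GF(2) the affine combinations of three points are exactly the sums x + y + z.
AffinelyClosed : ∀ {n} → Subset n → Set
AffinelyClosed B =
  ∀ x y z → B x ≡ true → B y ≡ true → B z ≡ true → B ((x ⊕ y) ⊕ z) ≡ true

affinelyClosed⇒isCoset : ∀ {n} {B : Subset n} {p : Vc n} →
  AffinelyClosed B → B p ≡ true → IsCoset B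
affinelyClosed⇒isCoset {B = B} {p} closed Bp =
  (λ w → B (w ⊕ p)) , p , (zero∈W , ⊕-closed) , λ x → cong B (sym (⊕-cancelʳ x p))
  where
  zero∈W : B (𝟎 ⊕ p) ≡ true
  zero∈W = trans (cong B (⊕-identityˡ p)) Bp
  ⊕-closed : ∀ x y → B (x ⊕ p) ≡ true → B (y ⊕ p) ≡ true → B ((x ⊕ y) ⊕ p) ≡ true
  ⊕-closed x y Bx By = begin
    B ((x ⊕ y) ⊕ p)                           ≡⟨ cong (λ v → B (v ⊕ p)) (⊕-shift-pair x y p) ⟨
    B (((x ⊕ p) ⊕ (y ⊕ p)) ⊕ p)               ≡⟨ closed _ _ _ Bx By Bp ⟩
    true                                      ∎

affinelyClosed-preimage : ∀ {n} {g : Aff n} {B C : Subset n} →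
  MapsTo g B C → AffinelyClosed C → AffinelyClosed B
affinelyClosed-preimage {g = g} {B} {C} g[B]≡C closed x y z Bx By Bz = begin
  B ((x ⊕ y) ⊕ z)                              ≡⟨ g[B]≡C _ ⟩
  C (apply g ((x ⊕ y) ⊕ z))                    ≡⟨ cong C (apply-⊕₃ g x y z) ⟩
  C ((apply g x ⊕ apply g y) ⊕ apply g z)      ≡⟨ closed _ _ _ (image Bx) (image By) (image Bz) ⟩
  true                                         ∎
  where
  image : ∀ {w} → B w ≡ true → C (apply g w) ≡ true
  image {w} Bw = trans (sym (g[B]≡C w)) Bw

count : ∀ {A : Set} → (A → Bool) → List A → ℕ
count P xs = length (filterᵇ P xs)

_⊆ᵇ_ : ∀ {A : Set} → (A → Bool) → (A → Bool) → Set
P ⊆ᵇ Q = ∀ x → P x ≡ true → Q x ≡ true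

Disjointᵇ : ∀ {A : Set} → (A → Bool) → (A → Bool) → Set
Disjointᵇ P Q = ∀ x → P x ≡ true → Q x ≡ true → ⊥

count-++ : ∀ {A : Set} (P : A → Bool) xs ys → count P (xs ++ ys) ≡ count P xs + count P ys
count-++ P [] ys = refl
count-++ P (x ∷ xs) ys with P x
... | true = cong suc (count-++ P xs ys)
... | false = count-++ P xs ys

count-map : ∀ {A B : Set} (P : B → Bool) (f : A → B) xs →
  count P (map f xs) ≡ count (λ x → P (f x)) xs
count-map P f [] = refl
count-map P f (x ∷ xs) with P (f x)
... | true = cong suc (count-map P f xs)
... | false = count-map P f xs

count-mono : ∀ {A : Set} {P Q : A → Bool} → P ⊆ᵇ Q → ∀ xs → count P xs ≤ count Q xs
count-mono P⊆Q [] = z≤n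
count-mono {P = P} {Q} P⊆Q (x ∷ xs) with P x in Px | Q x in Qx
... | true  | true  = s≤s (count-mono P⊆Q xs)
... | false | true  = m≤n⇒m≤1+n (count-mono P⊆Q xs)
... | false | false = count-mono P⊆Q xs
... | true  | false with () ← trans (sym Qx) (P⊆Q x Px)

count-∨ : ∀ {A : Set} {P Q : A → Bool} → Disjointᵇ P Q →
  ∀ xs → count (λ x → P x ∨ Q x) xs ≡ count P xs + count Q xs
count-∨ P#Q [] = refl
count-∨ {P = P} {Q} P#Q (x ∷ xs) with P x in Px | Q x in Qx
... | true  | true  = ⊥-elim (P#Q x Px Qx)
... | true  | false = cong suc (count-∨ P#Q xs)
... | false | true  = trans (cong suc (count-∨ P#Q xs)) (sym (+-suc _ _))
... | false | false = count-∨ P#Q xs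

count-three-disjoint : ∀ {A : Set} {P₁ P₂ P₃ R : A → Bool} →
  P₁ ⊆ᵇ R → P₂ ⊆ᵇ R → P₃ ⊆ᵇ R →
  Disjointᵇ P₁ P₂ → Disjointᵇ P₁ P₃ → Disjointᵇ P₂ P₃ →
  ∀ xs → count P₁ xs + (count P₂ xs + count P₃ xs) ≤ count R xs
count-three-disjoint {A = A} {P₁} {P₂} {P₃} {R} P₁⊆R P₂⊆R P₃⊆R P₁#P₂ P₁#P₃ P₂#P₃ xs =
  ≤-trans (≤-reflexive sizes) (count-mono union⊆R xs)
  where
  P₂₃ : A → Bool
  P₂₃ x = P₂ x ∨ P₃ x
  P₁#P₂₃ : Disjointᵇ P₁ P₂₃
  P₁#P₂₃ x P₁x P₂₃x with P₂ x in P₂x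
  ... | true = P₁#P₂ x P₁x P₂x
  ... | false = P₁#P₃ x P₁x P₂₃x
  union⊆R : (λ x → P₁ x ∨ P₂₃ x) ⊆ᵇ R
  union⊆R x h with P₁ x in P₁x | P₂ x in P₂x | P₃ x in P₃x
  ... | true  | _     | _    = P₁⊆R x P₁x
  ... | false | true  | _    = P₂⊆R x P₂x
  ... | false | false | true = P₃⊆R x P₃x
  sizes : count P₁ xs + (count P₂ xs + count P₃ xs) ≡ count (λ x → P₁ x ∨ P₂₃ x) xs
  sizes = begin
    count P₁ xs + (count P₂ xs + count P₃ xs)  ≡⟨ cong (count P₁ xs +_) (count-∨ P₂#P₃ xs) ⟨
    count P₁ xs + count P₂₃ xs                 ≡⟨ count-∨ P₁#P₂₃ xs ⟨
    count (λ x → P₁ x ∨ P₂₃ x) xs              ∎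

count-pos⇒∃ : ∀ {A : Set} (P : A → Bool) xs → 0 < count P xs → ∃[ x ] P x ≡ true
count-pos⇒∃ P (x ∷ xs) pos with P x in Px
... | true = x , Px
... | false = count-pos⇒∃ P xs pos

allVecs-complete : ∀ n (x : Vc n) → x ∈ allVecs n
allVecs-complete zero [] = here refl
allVecs-complete (suc n) (false ∷ x) = ∈-++⁺ˡ (∈-map⁺ (false ∷_) (allVecs-complete n x))
allVecs-complete (suc n) (true ∷ x) =
  ∈-++⁺ʳ (map (false ∷_) (allVecs n)) (∈-map⁺ (true ∷_) (allVecs-complete n x))

count-allVecs-suc : ∀ n (P : Vc (suc n) → Bool) →
  count P (allVecs (suc n)) ≡
  count (λ v → P (false ∷ v)) (allVecs n) + count (λ v → P (true ∷ v)) (allVecs n)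
count-allVecs-suc n P = begin
  count P (map (false ∷_) (allVecs n) ++ map (true ∷_) (allVecs n))
    ≡⟨ count-++ P (map (false ∷_) (allVecs n)) (map (true ∷_) (allVecs n)) ⟩
  count P (map (false ∷_) (allVecs n)) + count P (map (true ∷_) (allVecs n))
    ≡⟨ cong₂ _+_ (count-map P (false ∷_) (allVecs n)) (count-map P (true ∷_) (allVecs n)) ⟩
  count (λ v → P (false ∷ v)) (allVecs n) + count (λ v → P (true ∷ v)) (allVecs n)  ∎

count-translate : ∀ n (P : Vc n → Bool) (c : Vc n) →
  count (λ u → P (c ⊕ u)) (allVecs n) ≡ count P (allVecs n)
count-translate zero P [] with P []
... | true = refl
... | false = refl
count-translate (suc n) P (false ∷ c) = begin
  count (λ u → P ((false ∷ c) ⊕ u)) (allVecs (suc n))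
    ≡⟨ count-allVecs-suc n _ ⟩
  count (λ v → P (false ∷ c ⊕ v)) (allVecs n) + count (λ v → P (true ∷ c ⊕ v)) (allVecs n)
    ≡⟨ cong₂ _+_ (count-translate n _ c) (count-translate n _ c) ⟩
  count (λ v → P (false ∷ v)) (allVecs n) + count (λ v → P (true ∷ v)) (allVecs n)
    ≡⟨ count-allVecs-suc n P ⟨
  count P (allVecs (suc n))  ∎
count-translate (suc n) P (true ∷ c) = begin
  count (λ u → P ((true ∷ c) ⊕ u)) (allVecs (suc n))
    ≡⟨ count-allVecs-suc n _ ⟩
  count (λ v → P (true ∷ c ⊕ v)) (allVecs n) + count (λ v → P (false ∷ c ⊕ v)) (allVecs n)
    ≡⟨ cong₂ _+_ (count-translate n _ c) (count-translate n _ c) ⟩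
  count (λ v → P (true ∷ v)) (allVecs n) + count (λ v → P (false ∷ v)) (allVecs n)
    ≡⟨ +-comm (count (λ v → P (true ∷ v)) (allVecs n)) _ ⟩
  count (λ v → P (false ∷ v)) (allVecs n) + count (λ v → P (true ∷ v)) (allVecs n)
    ≡⟨ count-allVecs-suc n P ⟨
  count P (allVecs (suc n))  ∎

allᵇ-sound : ∀ {A : Set} (p : A → Bool) {xs x} → allᵇ p xs ≡ true → x ∈ xs → p x ≡ true
allᵇ-sound p {y ∷ ys} h x∈ with p y in py | h | x∈
... | true | h | here refl = py
... | true | h | there x∈ys = allᵇ-sound p h x∈ys

allᵇ-complete : ∀ {A : Set} (p : A → Bool) xs → (∀ x → p x ≡ true) → allᵇ p xs ≡ true
allᵇ-complete p [] px = refl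
allᵇ-complete p (y ∷ ys) px rewrite px y = allᵇ-complete p ys px

≟B-sound : ∀ a b → does (a ≟B b) ≡ true → a ≡ b
≟B-sound false false _ = refl
≟B-sound true true _ = refl

≟B-refl : ∀ a → does (a ≟B a) ≡ true
≟B-refl false = refl
≟B-refl true = refl

fixesᵇ-sound : ∀ {n} (B : Subset n) {s} → fixesᵇ B s ≡ true → ∀ x → B (x ⊕ s) ≡ B x
fixesᵇ-sound {n} B h x = ≟B-sound _ _ (allᵇ-sound _ h (allVecs-complete n x))

fixesᵇ-complete : ∀ {n} {B : Subset n} {s} → (∀ x → B (x ⊕ s) ≡ B x) → fixesᵇ B s ≡ true
fixesᵇ-complete {n} {B} h =
  allᵇ-complete _ (allVecs n) λ x → trans (cong (λ b → does (b ≟B B x)) (h x)) (≟B-refl (B x))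

fixesᵇ-⊕ : ∀ {n} {B : Subset n} {s s′} → fixesᵇ B s ≡ true → fixesᵇ B s′ ≡ true →
  fixesᵇ B (s ⊕ s′) ≡ true
fixesᵇ-⊕ {B = B} {s} {s′} fs fs′ = fixesᵇ-complete λ x → begin
  B (x ⊕ (s ⊕ s′))  ≡⟨ cong B (⊕-assoc x s s′) ⟨
  B ((x ⊕ s) ⊕ s′)  ≡⟨ fixesᵇ-sound B fs′ (x ⊕ s) ⟩
  B (x ⊕ s)         ≡⟨ fixesᵇ-sound B fs x ⟩
  B x               ∎

stabiliserCoset : ∀ {n} → Subset n → Vc n → Subset n
stabiliserCoset B x u = fixesᵇ B (x ⊕ u)

stabiliserCoset⊆ : ∀ {n} {B : Subset n} {x} → B x ≡ true → stabiliserCoset B x ⊆ᵇ B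
stabiliserCoset⊆ {B = B} {x} Bx u fixes = begin
  B u                ≡⟨ cong B (⊕-cancelˡ x u) ⟨
  B (x ⊕ (x ⊕ u))    ≡⟨ fixesᵇ-sound B fixes x ⟩
  B x                ≡⟨ Bx ⟩
  true               ∎

stabiliserCosets-disjoint : ∀ {n} (B : Subset n) {x y} → fixesᵇ B (x ⊕ y) ≡ false →
  Disjointᵇ (stabiliserCoset B x) (stabiliserCoset B y)
stabiliserCosets-disjoint B {x} {y} x+y∉S u fx fy with () ← begin
  false                              ≡⟨ x+y∉S ⟨
  fixesᵇ B (x ⊕ y)                   ≡⟨ cong (fixesᵇ B) (⊕-shift-pair x y u) ⟨
  fixesᵇ B ((x ⊕ u) ⊕ (y ⊕ u))       ≡⟨ fixesᵇ-⊕ {B = B} fx fy ⟩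
  true                               ∎

count-stabiliserCoset : ∀ {n} (B : Subset n) x → count (stabiliserCoset B x) (allVecs n) ≡ ∣T B ∣
count-stabiliserCoset {n} B x = count-translate n (fixesᵇ B) x

large-translation-stabiliser⇒affinelyClosed : ∀ {n} (B : Subset n) →
  ∣ B ∣ˢ < 3 * ∣T B ∣ → AffinelyClosed B
large-translation-stabiliser⇒affinelyClosed {n} B small x y z Bx By Bz
  with fixesᵇ B (x ⊕ y) in xy | fixesᵇ B (y ⊕ z) in yz | fixesᵇ B (x ⊕ z) in xz
... | true | _ | _ = trans (cong B (⊕-comm (x ⊕ y) z)) (trans (fixesᵇ-sound B xy z) Bz)
... | false | true | _ = trans (cong B (⊕-assoc x y z)) (trans (fixesᵇ-sound B yz x) Bx)
... | false | false | true = trans (cong B (⊕-xy∙z≈y∙xz x y z)) (trans (fixesᵇ-sound B xz y) By)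
... | false | false | false = ⊥-elim (<⇒≱ small (≤-trans (≤-reflexive three-cosets) disjoint-in-B))
  where
  coset : Vc n → ℕ
  coset w = count (stabiliserCoset B w) (allVecs n)
  three-cosets : 3 * ∣T B ∣ ≡ coset x + (coset y + coset z)
  three-cosets = begin
    ∣T B ∣ + (∣T B ∣ + (∣T B ∣ + 0))  ≡⟨ cong (λ k → ∣T B ∣ + (∣T B ∣ + k)) (+-identityʳ _) ⟩
    ∣T B ∣ + (∣T B ∣ + ∣T B ∣)        ≡⟨ cong₂ _+_ (count-stabiliserCoset B x)
                                        (cong₂ _+_ (count-stabiliserCoset B y) (count-stabiliserCoset B z)) ⟨
    coset x + (coset y + coset z)    ∎
  disjoint-in-B : coset x + (coset y + coset z) ≤ ∣ B ∣ˢ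
  disjoint-in-B = count-three-disjoint (stabiliserCoset⊆ Bx) (stabiliserCoset⊆ By) (stabiliserCoset⊆ Bz)
    (stabiliserCosets-disjoint B xy) (stabiliserCosets-disjoint B xz) (stabiliserCosets-disjoint B yz)
    (allVecs n)

2^[1+m]<3*2^t : ∀ m t → m ≤ t → 2 ^ suc m < 3 * 2 ^ t
2^[1+m]<3*2^t m t m≤t =
  ≤-<-trans (*-monoʳ-≤ 2 (^-monoʳ-≤ 2 m≤t)) (*-monoˡ-< (2 ^ t) {{m^n≢0 2 t}} {2} {3} ≤-refl)

corollary2p4 : (m : ℕ) → 1 ≤ m →
    (blocks : List (Subset (2 * m))) (lam : ℕ) →
    Is2Design blocks (2 ^ m) lam →
    2 < 2 ^ m → 2 ^ m < 2 ^ (2 * m) →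
    lam ∣ 2 ^ m →
    (G : Aff (2 * m) → Set) →
    IsSubgroupOfAGL G → ContainsTranslations G →
    IsAutGroup G blocks → FlagTransitive G blocks →
    (B₀ : Subset (2 * m)) → B₀ ∈ blocks →
    (t : ℕ) → ∣T B₀ ∣ ≡ 2 ^ t → m ∸ 1 ≤ t →
    ∀ B → B ∈ blocks → IsCoset B
corollary2p4 (suc m) _ blocks _ design _ _ _ _ _ _ _ flagTransitive B₀ B₀∈ t ∣T₀∣ m≤t B B∈ =
  let p , Bp = nonempty B∈
      q , B₀q = nonempty B₀∈
      _ , _ , _ , g[B]≡B₀ = flagTransitive p B q B₀ B∈ Bp B₀∈ B₀q
  in affinelyClosed⇒isCoset (affinelyClosed-preimage g[B]≡B₀ B₀-closed) Bp
  where
  open Is2Design design using (blockSize)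
  nonempty : ∀ {C} → C ∈ blocks → ∃[ p ] C p ≡ true
  nonempty {C} C∈ = count-pos⇒∃ C (allVecs _) (subst (0 <_) (sym (blockSize C C∈)) (m^n>0 2 (suc m)))
  B₀-closed : AffinelyClosed B₀
  B₀-closed = large-translation-stabiliser⇒affinelyClosed B₀
    (subst₂ (λ k s → k < 3 * s) (sym (blockSize B₀ B₀∈)) (sym ∣T₀∣) (2^[1+m]<3*2^t m t m≤t))
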